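{- Let $G=(A\cup B,E)$ be a marriage instance with strict preferences, augmented with self-loops as described in the context, and let $S$ be a perfect matching of the augmented graph $G=(A\cup B,E')$. Let $S'=\{(a^-_\ell,b^+_r),(b^-_\ell,a^+_r): (a,b)\in S\cap E\}\cup\{(u^-_\ell,u^+_r):(u,u)\in S\}$, a matching of the graph $H$ defined in the context. If $S$ is stable in $G$, then $S'$ is stable in $H$.
   Context: $G=(A\cup B,E)$ is bipartite and every vertex has a strict ranking of its neighbors. Augment $G$ with a self-loop $(u,u)$ at every vertex $u$, placed at the bottom of $u$'s preference list; $E'=E\cup\{(u,u):u\in A\cup B\}$. Any matching of $G$ is viewed as a perfect matching of $(A\cup B,E')$ by matching uncovered vertices to themselves. A matching $S$ is stable in $G$ if there is no edge $(a,b)\in E$ such that $a$ and $b$ both prefer each other to their respective assignments in $S$. The graph $H$: for each $u\in A\cup B$ there are two vertices $u_\ell$ (left side) and $u_r$ (right side). For each $(a,b)\in E$, $H$ has four edges: two parallel edges between $a_\ell$ and $b_r$, denoted $(a_\ell^+,b_r^-)$ and $(a_\ell^-,b_r^+)$, and two parallel edges between $b_\ell$ and $a_r$, denoted $(b_\ell^+,a_r^-)$ and $(b_\ell^-,a_r^+)$. For each $u\in A\cup B$, $H$ has one edge $(u_\ell^-,u_r^+)$. In an edge $(x^\sigma,y^\tau)$, we say that from $x$'s point of view the edge goes to the neighbor $y^\tau$ (superscript $\tau$). Preferences in $H$ (over incident edges, described via the superscripted neighbor): if $u$'s preference order in $G$ is $v\succ v'\succ\cdots\succ v''$, then $u_\ell$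 ranks $v_r^-\succ v_r'^-\succ\cdots\succ v_r''^-\succ v_r^+\succ v_r'^+\succ\cdots\succ v_r''^+\succ u_r^+$, and $u_r$ ranks $v_\ell^-\succ v_\ell'^-\succ\cdots\succ v_\ell''^-\succ u_\ell^-\succ v_\ell^+\succ v_\ell'^+\succ\cdots\succ v_\ell''^+$. An edge $(x^\sigma,y^\tau)$ of $H$ blocks a matching $M$ of $H$ if $x$ prefers $y^\tau$ to its assignment in $M$ and $y$ prefers $x^\sigma$ to its assignment in $M$ (being unmatched is worst). A matching of $H$ is stable if no edge of $H$ blocks it. -}

module Defs where

open import Data.Nat using (ℕ; _<_)
open import Data.Fin using (Fin)
open import Data.Bool using (Bool; T)
open import Data.Sum using (_⊎_; inj₁; inj₂)
open import Data.Product using (_×_; Σ)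
open import Data.Empty using (⊥)
open import Data.Unit using (⊤)
open import Relation.Binary.PropositionalEquality using (_≡_)
open import Relation.Nullary using (¬_)

-- Each vertex u ranks its neighbours via
-- rank u v : ℕ (smaller = more preferred); the ranking is strict,
-- i.e. rank u is injective on the neighbours of u.

Vtx : ℕ → ℕ → Set
Vtx m n = Fin m ⊎ Fin n

AdjE : {m n : ℕ} → (Fin m → Fin n → Bool) → Vtx m n → Vtx m n → Set
AdjE E (inj₁ a) (inj₂ b) = T (E a b)
AdjE E (inj₂ b) (inj₁ a) = T (E a b)
AdjE E (inj₁ _) (inj₁ _) = ⊥
AdjE E (inj₂ _) (inj₂ _) = ⊥

record Instance (m n : ℕ) : Set where
  field
    E      : Fin m → Fin n → Bool
    rank   : Vtx m n → Vtx m n → ℕ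
    strict : ∀ u v w → AdjE E u v → AdjE E u w → rank u v ≡ rank u w → v ≡ w

  Adj : Vtx m n → Vtx m n → Set
  Adj = AdjE E

module _ {m n : ℕ} (I : Instance m n) where
  open Instance I

  data GEdge : Set where
    gpair : Fin m → Fin n → GEdge
    gloop : Vtx m n → GEdge

  ValidG : GEdge → Set
  ValidG (gpair a b) = T (E a b)
  ValidG (gloop _)   = ⊤

  Covers : GEdge → Vtx m n → Set
  Covers (gpair a b) (inj₁ a') = a ≡ a'
  Covers (gpair a b) (inj₂ b') = b ≡ b'
  Covers (gloop u)   v         = u ≡ v

  IsPerfectMatchingG : (GEdge → Set) → Set
  IsPerfectMatchingG S =
    (∀ e → S e → ValidG e)
    × (∀ v → Σ GEdge λ e → S e × Covers e v)
    × (∀ e e' v → S e → S e' → Covers e v → Covers e' v → e ≡ e')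

  -- u (covered by e) prefers its neighbour v to its assignment in e.
  -- The self-loop is at the bottom of every list.
  PrefG : Vtx m n → Vtx m n → GEdge → Set
  PrefG u        v (gloop _)   = ⊤
  PrefG (inj₁ a) v (gpair _ b) = rank (inj₁ a) v < rank (inj₁ a) (inj₂ b)
  PrefG (inj₂ b) v (gpair a _) = rank (inj₂ b) v < rank (inj₂ b) (inj₁ a)

  BlocksG : (GEdge → Set) → Fin m → Fin n → Set
  BlocksG S a b =
    (∀ e → S e → Covers e (inj₁ a) → PrefG (inj₁ a) (inj₂ b) e)
    × (∀ e → S e → Covers e (inj₂ b) → PrefG (inj₂ b) (inj₁ a) e)

  StableG : (GEdge → Set) → Set
  StableG S = ∀ a b → T (E a b) → ¬ BlocksG S a b

  -- The graph H.  Vertices: u_ℓ and u_r for u ∈ A ∪ B.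
  -- Every edge of H joins a left vertex to a right vertex.

  data Sign : Set where
    plus minus : Sign

  data HEdge : Set where
    -- hpair u w σ  is the edge (u_ℓ^σ , w_r^{-σ}), present for (u,w) adjacent in G
    hpair : Vtx m n → Vtx m n → Sign → HEdge
    -- hself u  is the edge (u_ℓ^- , u_r^+)
    hself : Vtx m n → HEdge

  ValidH : HEdge → Set
  ValidH (hpair u w _) = Adj u w
  ValidH (hself _)     = ⊤

  leftEnd : HEdge → Vtx m n
  leftEnd (hpair u _ _) = u
  leftEnd (hself u)     = u

  rightEnd : HEdge → Vtx m n
  rightEnd (hpair _ w _) = w
  rightEnd (hself u)     = u

  IsMatchingH : (HEdge → Set) → Set
  IsMatchingH M =
    (∀ e → M e → ValidH e)
    × (∀ e e' → M e → M e' → leftEnd e ≡ leftEnd e' → e ≡ e')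
    × (∀ e e' → M e → M e' → rightEnd e ≡ rightEnd e' → e ≡ e')

  -- PrefL u e e' : u_ℓ strictly prefers edge e to edge e' (both incident to u_ℓ).
  -- u_ℓ ranks  v_r^- (by G-rank) ≻ v_r^+ (by G-rank) ≻ u_r^+ .
  -- Edge hpair u w σ goes (from u_ℓ) to w_r^{-σ}.
  PrefL : Vtx m n → HEdge → HEdge → Set
  PrefL u (hpair _ w plus)  (hpair _ w' plus)  = rank u w < rank u w'
  PrefL u (hpair _ _ plus)  (hpair _ _ minus)  = ⊤
  PrefL u (hpair _ _ plus)  (hself _)          = ⊤
  PrefL u (hpair _ _ minus) (hpair _ _ plus)   = ⊥
  PrefL u (hpair _ w minus) (hpair _ w' minus) = rank u w < rank u w'
  PrefL u (hpair _ _ minus) (hself _)          = ⊤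
  PrefL u (hself _)         _                  = ⊥

  -- PrefR u e e' : u_r strictly prefers edge e to edge e' (both incident to u_r).
  -- u_r ranks  v_ℓ^- (by G-rank) ≻ u_ℓ^- ≻ v_ℓ^+ (by G-rank).
  -- Edge hpair w u σ goes (from u_r) to w_ℓ^σ; hself u goes to u_ℓ^-.
  PrefR : Vtx m n → HEdge → HEdge → Set
  PrefR u (hpair w _ minus) (hpair w' _ minus) = rank u w < rank u w'
  PrefR u (hpair _ _ minus) (hself _)          = ⊤
  PrefR u (hpair _ _ minus) (hpair _ _ plus)   = ⊤
  PrefR u (hself _)         (hpair _ _ minus)  = ⊥
  PrefR u (hself _)         (hself _)          = ⊥
  PrefR u (hself _)         (hpair _ _ plus)   = ⊤
  PrefR u (hpair _ _ plus)  (hpair _ _ minus)  = ⊥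
  PrefR u (hpair _ _ plus)  (hself _)          = ⊥
  PrefR u (hpair w _ plus)  (hpair w' _ plus)  = rank u w < rank u w'

  -- e blocks M: both endpoints strictly prefer e to their assignment in M
  -- (being unmatched is worst, so the condition is vacuous then).
  BlocksH : (HEdge → Set) → HEdge → Set
  BlocksH M e =
    (∀ e' → M e' → leftEnd e' ≡ leftEnd e → PrefL (leftEnd e) e e')
    × (∀ e' → M e' → rightEnd e' ≡ rightEnd e → PrefR (rightEnd e) e e')

  StableH : (HEdge → Set) → Set
  StableH M = IsMatchingH M × (∀ e → ValidH e → ¬ BlocksH M e)

  lift : (GEdge → Set) → HEdge → Set
  lift S (hpair (inj₁ a) (inj₂ b) minus) = S (gpair a b)
  lift S (hpair (inj₂ b) (inj₁ a) minus) = S (gpair a b)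
  lift S (hpair (inj₁ _) (inj₁ _) _)     = ⊥
  lift S (hpair (inj₂ _) (inj₂ _) _)     = ⊥
  lift S (hpair (inj₁ _) (inj₂ _) plus)  = ⊥
  lift S (hpair (inj₂ _) (inj₁ _) plus)  = ⊥
  lift S (hself u)                       = S (gloop u)

{-# OPTIONS --safe #-}
module Submission where

open import Defs
open import Data.Nat using (ℕ)
open import Data.Sum using (inj₁; inj₂)
open import Data.Product using (Σ; _×_; _,_)
open import Data.Unit using (tt)
open import Relation.Binary.PropositionalEquality
  using (_≡_; refl; sym; subst; cong₂; module ≡-Reasoning)
open import Relation.Nullary using (¬_)

-- Every edge (a,b) of S yields the two minus-edges of S', one at a_ℓ and one at b_ℓ;
-- so S' matches each u_ℓ and each u_r exactly once, via the S-edge at u. A self-edge u_ℓ u_r is last for u_ℓ, and a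
-- plus-edge is worse for its right end than every minus- or self-edge, so neither
-- can block. A blocking minus-edge between a and b compares, at both ends, the same
-- G-ranks as the pair (a,b) compares against S, so it would make (a,b) block S.

module _ {m n : ℕ} (I : Instance m n) where
  open Instance I

  edgeAtLeft : GEdge I → Vtx m n → HEdge I
  edgeAtLeft (gpair a b) (inj₁ _) = hpair (inj₁ a) (inj₂ b) minus
  edgeAtLeft (gpair a b) (inj₂ _) = hpair (inj₂ b) (inj₁ a) minus
  edgeAtLeft (gloop u)   _        = hself u

  edgeAtRight : GEdge I → Vtx m n → HEdge I
  edgeAtRight (gpair a b) (inj₁ _) = hpair (inj₂ b) (inj₁ a) minus
  edgeAtRight (gpair a b) (inj₂ _) = hpair (inj₁ a) (inj₂ b) minus
  edgeAtRight (gloop u)   _        = hself u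

  -- Edges inside one side of the bipartition are sent to a loop at their left end;
  -- they never occur in a lifted matching.
  baseEdge : HEdge I → GEdge I
  baseEdge (hpair (inj₁ a) (inj₂ b) _) = gpair a b
  baseEdge (hpair (inj₂ b) (inj₁ a) _) = gpair a b
  baseEdge (hpair u@(inj₁ _) (inj₁ _) _) = gloop u
  baseEdge (hpair u@(inj₂ _) (inj₂ _) _) = gloop u
  baseEdge (hself u) = gloop u

  leftEnd-edgeAtLeft : ∀ e v → Covers I e v → leftEnd I (edgeAtLeft e v) ≡ v
  leftEnd-edgeAtLeft (gpair a b) (inj₁ _) refl = refl
  leftEnd-edgeAtLeft (gpair a b) (inj₂ _) refl = refl
  leftEnd-edgeAtLeft (gloop u)   _        refl = refl

  rightEnd-edgeAtRight : ∀ e v → Covers I e v → rightEnd I (edgeAtRight e v) ≡ v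
  rightEnd-edgeAtRight (gpair a b) (inj₁ _) refl = refl
  rightEnd-edgeAtRight (gpair a b) (inj₂ _) refl = refl
  rightEnd-edgeAtRight (gloop u)   _        refl = refl

  PrefL-edgeAtLeft⇒PrefG : ∀ e u w →
    PrefL I u (hpair u w minus) (edgeAtLeft e u) → PrefG I u w e
  PrefL-edgeAtLeft⇒PrefG (gpair a b) (inj₁ _) w p = p
  PrefL-edgeAtLeft⇒PrefG (gpair a b) (inj₂ _) w p = p
  PrefL-edgeAtLeft⇒PrefG (gloop _)   u        w p = tt

  PrefR-edgeAtRight⇒PrefG : ∀ e w u →
    PrefR I w (hpair u w minus) (edgeAtRight e w) → PrefG I w u e
  PrefR-edgeAtRight⇒PrefG (gpair a b) (inj₁ _) u p = p
  PrefR-edgeAtRight⇒PrefG (gpair a b) (inj₂ _) u p = p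
  PrefR-edgeAtRight⇒PrefG (gloop _)   w        u p = tt

  PrefR-plus-edgeAtRight : ∀ e w u u′ → ¬ PrefR I w (hpair u u′ plus) (edgeAtRight e w)
  PrefR-plus-edgeAtRight (gpair a b) (inj₁ _) u u′ ()
  PrefR-plus-edgeAtRight (gpair a b) (inj₂ _) u u′ ()
  PrefR-plus-edgeAtRight (gloop _)   w        u u′ ()

  module _ (S : GEdge I → Set) where

    lift-edgeAtLeft : ∀ e v → S e → lift I S (edgeAtLeft e v)
    lift-edgeAtLeft (gpair a b) (inj₁ _) s = s
    lift-edgeAtLeft (gpair a b) (inj₂ _) s = s
    lift-edgeAtLeft (gloop _)   _        s = s

    lift-edgeAtRight : ∀ e v → S e → lift I S (edgeAtRight e v)
    lift-edgeAtRight (gpair a b) (inj₁ _) s = s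
    lift-edgeAtRight (gpair a b) (inj₂ _) s = s
    lift-edgeAtRight (gloop _)   _        s = s

    lift⇒base : ∀ h → lift I S h → S (baseEdge h)
    lift⇒base (hpair (inj₁ a) (inj₂ b) minus) s = s
    lift⇒base (hpair (inj₂ b) (inj₁ a) minus) s = s
    lift⇒base (hself u)                       s = s

    lift⇒ValidH : (∀ e → S e → ValidG I e) → ∀ h → lift I S h → ValidH I h
    lift⇒ValidH valid (hpair (inj₁ a) (inj₂ b) minus) s = valid (gpair a b) s
    lift⇒ValidH valid (hpair (inj₂ b) (inj₁ a) minus) s = valid (gpair a b) s
    lift⇒ValidH valid (hself u)                       s = tt

    baseEdge-covers-leftEnd : ∀ h → lift I S h → Covers I (baseEdge h) (leftEnd I h)
    baseEdge-covers-leftEnd (hpair (inj₁ a) (inj₂ b) minus) _ = refl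
    baseEdge-covers-leftEnd (hpair (inj₂ b) (inj₁ a) minus) _ = refl
    baseEdge-covers-leftEnd (hself u)                       _ = refl

    baseEdge-covers-rightEnd : ∀ h → lift I S h → Covers I (baseEdge h) (rightEnd I h)
    baseEdge-covers-rightEnd (hpair (inj₁ a) (inj₂ b) minus) _ = refl
    baseEdge-covers-rightEnd (hpair (inj₂ b) (inj₁ a) minus) _ = refl
    baseEdge-covers-rightEnd (hself u)                       _ = refl

    edgeAtLeft-baseEdge : ∀ h → lift I S h → edgeAtLeft (baseEdge h) (leftEnd I h) ≡ h
    edgeAtLeft-baseEdge (hpair (inj₁ a) (inj₂ b) minus) _ = refl
    edgeAtLeft-baseEdge (hpair (inj₂ b) (inj₁ a) minus) _ = refl
    edgeAtLeft-baseEdge (hself u)                       _ = refl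

    edgeAtRight-baseEdge : ∀ h → lift I S h → edgeAtRight (baseEdge h) (rightEnd I h) ≡ h
    edgeAtRight-baseEdge (hpair (inj₁ a) (inj₂ b) minus) _ = refl
    edgeAtRight-baseEdge (hpair (inj₂ b) (inj₁ a) minus) _ = refl
    edgeAtRight-baseEdge (hself u)                       _ = refl

    module _ (unique : ∀ e e′ v → S e → S e′ → Covers I e v → Covers I e′ v → e ≡ e′) where
      open ≡-Reasoning

      lift-unique-leftEnd : ∀ h h′ → lift I S h → lift I S h′ → leftEnd I h ≡ leftEnd I h′ → h ≡ h′
      lift-unique-leftEnd h h′ s s′ eq = begin
        h                                          ≡⟨ sym (edgeAtLeft-baseEdge h s) ⟩
        edgeAtLeft (baseEdge h) (leftEnd I h)      ≡⟨ cong₂ edgeAtLeft sameBase eq ⟩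
        edgeAtLeft (baseEdge h′) (leftEnd I h′)    ≡⟨ edgeAtLeft-baseEdge h′ s′ ⟩
        h′                                         ∎
        where
        sameBase : baseEdge h ≡ baseEdge h′
        sameBase = unique _ _ (leftEnd I h) (lift⇒base h s) (lift⇒base h′ s′)
          (baseEdge-covers-leftEnd h s)
          (subst (Covers I (baseEdge h′)) (sym eq) (baseEdge-covers-leftEnd h′ s′))

      lift-unique-rightEnd : ∀ h h′ → lift I S h → lift I S h′ → rightEnd I h ≡ rightEnd I h′ → h ≡ h′
      lift-unique-rightEnd h h′ s s′ eq = begin
        h                                          ≡⟨ sym (edgeAtRight-baseEdge h s) ⟩
        edgeAtRight (baseEdge h) (rightEnd I h)    ≡⟨ cong₂ edgeAtRight sameBase eq ⟩
        edgeAtRight (baseEdge h′) (rightEnd I h′)  ≡⟨ edgeAtRight-baseEdge h′ s′ ⟩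
        h′                                         ∎
        where
        sameBase : baseEdge h ≡ baseEdge h′
        sameBase = unique _ _ (rightEnd I h) (lift⇒base h s) (lift⇒base h′ s′)
          (baseEdge-covers-rightEnd h s)
          (subst (Covers I (baseEdge h′)) (sym eq) (baseEdge-covers-rightEnd h′ s′))

    lift-IsMatchingH : IsPerfectMatchingG I S → IsMatchingH I (lift I S)
    lift-IsMatchingH (valid , _ , unique) =
      lift⇒ValidH valid , lift-unique-leftEnd unique , lift-unique-rightEnd unique

    module _ (covered : ∀ v → Σ (GEdge I) λ e → S e × Covers I e v) where

      left-unblocked-self : ∀ u → ¬ (∀ h → lift I S h → leftEnd I h ≡ u → PrefL I u (hself u) h)
      left-unblocked-self u bl with covered u
      ... | e , s , c = bl (edgeAtLeft e u) (lift-edgeAtLeft e u s) (leftEnd-edgeAtLeft e u c)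

      right-unblocked-plus : ∀ u w →
        ¬ (∀ h → lift I S h → rightEnd I h ≡ w → PrefR I w (hpair u w plus) h)
      right-unblocked-plus u w br with covered w
      ... | e , s , c = PrefR-plus-edgeAtRight e w u w
        (br (edgeAtRight e w) (lift-edgeAtRight e w s) (rightEnd-edgeAtRight e w c))

    left-blocking⇒PrefG : ∀ u w →
      (∀ h → lift I S h → leftEnd I h ≡ u → PrefL I u (hpair u w minus) h) →
      ∀ e → S e → Covers I e u → PrefG I u w e
    left-blocking⇒PrefG u w bl e s c = PrefL-edgeAtLeft⇒PrefG e u w
      (bl (edgeAtLeft e u) (lift-edgeAtLeft e u s) (leftEnd-edgeAtLeft e u c))

    right-blocking⇒PrefG : ∀ u w →
      (∀ h → lift I S h → rightEnd I h ≡ w → PrefR I w (hpair u w minus) h) →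
      ∀ e → S e → Covers I e w → PrefG I w u e
    right-blocking⇒PrefG u w br e s c = PrefR-edgeAtRight⇒PrefG e w u
      (br (edgeAtRight e w) (lift-edgeAtRight e w s) (rightEnd-edgeAtRight e w c))

    lift-unblocked : IsPerfectMatchingG I S → StableG I S →
      ∀ h → ValidH I h → ¬ BlocksH I (lift I S) h
    lift-unblocked (_ , covered , _) _ (hself u) _ (bl , _) =
      left-unblocked-self covered u bl
    lift-unblocked (_ , covered , _) _ (hpair u w plus) _ (_ , br) =
      right-unblocked-plus covered u w br
    lift-unblocked _ stable (hpair (inj₁ a) (inj₂ b) minus) adj (bl , br) =
      stable a b adj (left-blocking⇒PrefG _ _ bl , right-blocking⇒PrefG _ _ br)
    lift-unblocked _ stable (hpair (inj₂ b) (inj₁ a) minus) adj (bl , br) =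
      stable a b adj (right-blocking⇒PrefG _ _ br , left-blocking⇒PrefG _ _ bl)

claim1 : ∀ {m n : ℕ} (I : Instance m n) (S : GEdge I → Set)
         → IsPerfectMatchingG I S
         → StableG I S
         → StableH I (lift I S)
claim1 I S pm stable = lift-IsMatchingH I S pm , lift-unblocked I S pm stable
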